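{- Let $n,s,k \in \mathbb{N}$ with $n \geqslant 2\binom{2s}{s}(k-1) + 1$. Then $m(n,2s,s,k) \leqslant n - 2k + 2$.
   Context: An $r$-colouring of the complete graph $K_n$ ($n \geqslant 2$) is any function $f: E(K_n) \to [r] = \{1,\dots,r\}$. For a subgraph $H \subseteq K_n$, $c_f(H) = |f(E(H))|$ is the number of distinct colours on edges of $H$. A graph on at least $k+1$ vertices is $k$-connected if deleting any at most $k-1$ vertices leaves a connected graph. $M(f,n,r,s,k)$ is the maximum number of vertices of a $k$-connected subgraph $H \subseteq K_n$ with $c_f(H) \leqslant s$ (taken to be $0$ if no such subgraph exists), and $m(n,r,s,k) = \min_f M(f,n,r,s,k)$, the minimum over all $r$-colourings $f$ of $E(K_n)$. -}

module Defs where

open import Data.Nat using (ℕ; zero; suc; _+_; _*_; _≤_; _<_)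
open import Data.Bool using (Bool; true; false; _∧_; _∨_)
open import Data.Fin using (Fin; zero; suc; _≟_)
open import Data.Fin.Subset using (Subset; _∈_; _∉_; ∣_∣)
open import Data.Vec using (tabulate)
open import Data.Product using (Σ; ∃; _×_; _,_)
open import Relation.Binary.PropositionalEquality using (_≡_; _≢_)
open import Relation.Nullary.Decidable using (⌊_⌋)

-- An r-colouring of E(K_n): a colour in [r] (represented by Fin r) for each
-- unordered pair {i,j}, i ≠ j.  Represented as a symmetric function on ordered
-- pairs; the values on the diagonal (i = j) are irrelevant junk.
record Colouring (n r : ℕ) : Set where
  field
    col : Fin n → Fin n → Fin r
    sym : ∀ i j → col i j ≡ col j i
open Colouring public

record Subgraph (n : ℕ) : Set where
  field
    V    : Subset n
    E    : Fin n → Fin n → Bool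
    Esym : ∀ i j → E i j ≡ E j i
    Eirr : ∀ i j → E i j ≡ true → i ≢ j
    EV   : ∀ i j → E i j ≡ true → (i ∈ V) × (j ∈ V)
open Subgraph public

anyFin : ∀ {n} → (Fin n → Bool) → Bool
anyFin {zero}  p = false
anyFin {suc n} p = p zero ∨ anyFin (λ i → p (suc i))

colourSet : ∀ {n r} → Colouring n r → Subgraph n → Subset r
colourSet f H = tabulate λ c →
  anyFin λ i → anyFin λ j → E H i j ∧ ⌊ col f i j ≟ c ⌋

c : ∀ {n r} → Colouring n r → Subgraph n → ℕ
c f H = ∣ colourSet f H ∣

data Reach {n : ℕ} (H : Subgraph n) (D : Subset n) : Fin n → Fin n → Set where
  here : ∀ {u} → u ∈ V H → u ∉ D → Reach H D u u
  step : ∀ {u w v} → u ∉ D → E H u w ≡ true → Reach H D w v → Reach H D u v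

ConnectedAfterDeleting : ∀ {n} → Subgraph n → Subset n → Set
ConnectedAfterDeleting {n} H D =
  ∀ (u v : Fin n) → u ∈ V H → u ∉ D → v ∈ V H → v ∉ D → Reach H D u v

KConnected : ∀ {n} → ℕ → Subgraph n → Set
KConnected {n} k H =
  (k + 1 ≤ ∣ V H ∣) × (∀ (D : Subset n) → ∣ D ∣ < k → ConnectedAfterDeleting H D)

-- "M(f,n,r,s,k) ≤ b": every k-connected subgraph H with c_f(H) ≤ s has at most
-- b vertices (M is the maximum of |V(H)| over such H, and 0 if there are none).
M≤ : ∀ {n r} → Colouring n r → (s k b : ℕ) → Set
M≤ {n} f s k b = ∀ (H : Subgraph n) → KConnected k H → c f H ≤ s → ∣ V H ∣ ≤ b

-- "m(n,r,s,k) ≤ b": m is the minimum of M(f,n,r,s,k) over all r-colourings f,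
-- so m ≤ b iff some r-colouring f has M(f,n,r,s,k) ≤ b.
m≤ : (n r s k b : ℕ) → Set
m≤ n r s k b = ∃ λ (f : Colouring n r) → M≤ f s k b

{-# OPTIONS --safe #-}
-- Each of the C(2s,s) s-sets B of the 2s colours owns a block of 2(k−1) consecutive vertices,
-- split into two halves of k−1 vertices; the vertices beyond the blocks own ∅. An edge gets a
-- colour outside the sets of both its ends unless these sets are complementary; then it gets a
-- colour of exactly one of them, chosen so that the edges on which a vertex v sees colours of
-- its own set all lead into a single half of the block of the complementary set.
-- Let H be k-connected with at most s colours, and B an s-set containing all of them. A vertex v
-- of H in the block of B keeps a neighbour w in H after deleting that half (fewer than k
-- vertices), yet the colour of vw lies in B. So H misses the whole block of B, and
-- |V(H)| ≤ n − 2(k−1).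
module Submission where

open import Defs hiding (sym)
open import Data.Nat using (ℕ; zero; suc; _+_; _*_; _∸_; _≤_; _<_; z≤n; s≤s; NonZero; _≟_; _<?_)
open import Data.Nat.Properties
  using ( ≤-refl; ≤-reflexive; ≤-trans; ≤-antisym; ≤-<-trans; ≤-pred; _≤?_; ≰⇒>; ≮⇒≥; <⇒≱; <⇒≢
        ; n≤1+n; m≤m+n; m≤n+m; suc-injective; +-comm; +-assoc; +-suc; +-identityʳ; +-cancelˡ-≡
        ; +-monoʳ-≤; +-monoʳ-<; +-monoˡ-<; *-monoˡ-≤; ∸-monoʳ-≤; n∸n≡0; m+n∸m≡n; m+n∸n≡m
        ; module ≤-Reasoning )
open import Data.Nat.DivMod using (_/_; _%_; m≡m%n+[m/n]*n; m%n<n; m*n/n≡m; /-monoˡ-≤; m<n*o⇒m/o<n)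
open import Data.Nat.Combinatorics using (_C_; nCk+nC[k+1]≡[n+1]C[k+1])
open import Data.Nat.Tactic.RingSolver using (solve-∀)
open import Data.Bool using (Bool; true; false; not; _∧_; _∨_; _xor_; if_then_else_)
import Data.Bool.Properties as Bool
open import Data.Fin as Fin using (Fin; zero; suc; toℕ)
open import Data.Fin.Properties using (any?; ¬∀⟶∃¬)
open import Data.Fin.Subset using (Subset; inside; outside; _∈_; _∉_; _⊆_; _∪_; _-_; ∁; ⊤; ⊥; ⁅_⁆; ∣_∣)
open import Data.Fin.Subset.Properties
  using ( _∈?_; anySubset?; ∈⊤; ⊆⊤; ⊆-refl; ⊆-antisym; s⊆s; in⊆in; out⊆; ∪-comm; x∈⁅x⁆
        ; x∈p∪q⁺; x∈p∪q⁻; x∈∁p⇒x∉p; x∉p⇒x∈∁p; x∈p∧x≢y⇒x∈p-y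
        ; ∣p∣≤n; ∣⊥∣≡0; ∣⊤∣≡n; ∣⁅x⁆∣≡1; ∣∁p∣≡n∸∣p∣; ∣p─q∣≤∣p∣; p⊆q⇒∣p∣≤∣q∣; p⊂q⇒∣p∣<∣q∣ )
open import Data.Vec using ([]; _∷_; here; there; lookup)
open import Data.Vec.Properties using (lookup⇒[]=; lookup∘tabulate; lookup-map; ≡-dec)
open import Data.Product using (∃; _×_; _,_; proj₁; proj₂; map)
open import Data.Sum using (inj₁; inj₂)
open import Data.Empty using (⊥-elim)
open import Function using (_∘_)
open import Relation.Binary.PropositionalEquality
  using (_≡_; _≢_; refl; sym; trans; cong; cong₂; subst; subst₂)
open import Relation.Nullary using (¬_; Dec; yes; no; does; contradiction)
open import Relation.Nullary.Decidable
  using (⌊_⌋; ¬?; _→-dec_; _×-dec_; decidable-stable; dec-true; isYes≗does)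

private variable
  n r : ℕ
  p q : Subset n

∣p∪q∣≤∣p∣+∣q∣ : ∀ (p q : Subset n) → ∣ p ∪ q ∣ ≤ ∣ p ∣ + ∣ q ∣
∣p∪q∣≤∣p∣+∣q∣ []             []             = z≤n
∣p∪q∣≤∣p∣+∣q∣ (outside ∷ p) (outside ∷ q) = ∣p∪q∣≤∣p∣+∣q∣ p q
∣p∪q∣≤∣p∣+∣q∣ (outside ∷ p) (inside ∷ q)  =
  ≤-trans (s≤s (∣p∪q∣≤∣p∣+∣q∣ p q)) (≤-reflexive (sym (+-suc ∣ p ∣ ∣ q ∣)))
∣p∪q∣≤∣p∣+∣q∣ (inside ∷ p)  (outside ∷ q) = s≤s (∣p∪q∣≤∣p∣+∣q∣ p q)
∣p∪q∣≤∣p∣+∣q∣ (inside ∷ p)  (inside ∷ q)  =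
  s≤s (≤-trans (∣p∪q∣≤∣p∣+∣q∣ p q) (≤-trans (n≤1+n _) (≤-reflexive (sym (+-suc ∣ p ∣ ∣ q ∣)))))

∣p∣<∣q∣⇒∃∈q∉p : ∣ p ∣ < ∣ q ∣ → ∃ λ x → x ∈ q × x ∉ p
∣p∣<∣q∣⇒∃∈q∉p {n} {p} {q} ∣p∣<∣q∣ with ¬∀⟶∃¬ n (λ x → x ∈ q → x ∈ p) (λ x → x ∈? q →-dec x ∈? p) q⊈p
  where
  q⊈p : ¬ (∀ x → x ∈ q → x ∈ p)
  q⊈p q⊆p = <⇒≱ ∣p∣<∣q∣ (p⊆q⇒∣p∣≤∣q∣ (q⊆p _))
... | x , x∈q↛x∈p =
  x , decidable-stable (x ∈? q) (λ x∉q → x∈q↛x∈p (⊥-elim ∘ x∉q)) , λ x∈p → x∈q↛x∈p (λ _ → x∈p)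

p≢⊤⇒∃∉ : p ≢ ⊤ → ∃ λ x → x ∉ p
p≢⊤⇒∃∉ {n} {p} p≢⊤ = ¬∀⟶∃¬ n (_∈ p) (_∈? p) (λ ∀∈p → p≢⊤ (⊆-antisym ⊆⊤ (λ {x} _ → ∀∈p x)))

⊆∧∣q∣≤∣p∣⇒≡ : p ⊆ q → ∣ q ∣ ≤ ∣ p ∣ → p ≡ q
⊆∧∣q∣≤∣p∣⇒≡ {p = p} {q = q} p⊆q ∣q∣≤∣p∣ = ⊆-antisym p⊆q q⊆p
  where
  q⊆p : q ⊆ p
  q⊆p {x} x∈q = decidable-stable (x ∈? p) λ x∉p → <⇒≱ (p⊂q⇒∣p∣<∣q∣ (p⊆q , x , x∈q , x∉p)) ∣q∣≤∣p∣

∪≡⊤⇒≡∁ : ∣ q ∣ ≤ ∣ ∁ p ∣ → p ∪ q ≡ ⊤ → q ≡ ∁ p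
∪≡⊤⇒≡∁ {q = q} {p = p} ∣q∣≤∣∁p∣ p∪q≡⊤ = sym (⊆∧∣q∣≤∣p∣⇒≡ ∁p⊆q ∣q∣≤∣∁p∣)
  where
  ∁p⊆q : ∁ p ⊆ q
  ∁p⊆q {x} x∈∁p with x∈p∪q⁻ p q (subst (x ∈_) (sym p∪q≡⊤) ∈⊤)
  ... | inj₁ x∈p = contradiction x∈p (x∈∁p⇒x∉p x∈∁p)
  ... | inj₂ x∈q = x∈q

x∉p-x : ∀ (p : Subset n) x → x ∉ p - x
x∉p-x (_ ∷ p) (suc x) (there x∈p-x) = x∉p-x p x x∈p-x

disjoint⇒∣q∣≤n∸∣p∣ : ∀ {p q : Subset n} → (∀ {x} → x ∈ p → x ∉ q) → ∣ q ∣ ≤ n ∸ ∣ p ∣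
disjoint⇒∣q∣≤n∸∣p∣ {n} {p} {q} disjoint = begin
  ∣ q ∣      ≤⟨ p⊆q⇒∣p∣≤∣q∣ (λ x∈q → x∉p⇒x∈∁p (λ x∈p → disjoint x∈p x∈q)) ⟩
  ∣ ∁ p ∣    ≡⟨ ∣∁p∣≡n∸∣p∣ p ⟩
  n ∸ ∣ p ∣  ∎
  where open ≤-Reasoning

superset-of-size : ∀ (p : Subset n) {t} → ∣ p ∣ ≤ t → t ≤ n → ∃ λ q → p ⊆ q × ∣ q ∣ ≡ t
superset-of-size []           {zero}  _           _         = [] , ⊆-refl , refl
superset-of-size (inside ∷ p) {suc t} (s≤s ∣p∣≤t) (s≤s t≤n) =
  let q , p⊆q , ∣q∣≡t = superset-of-size p ∣p∣≤t t≤n in inside ∷ q , in⊆in p⊆q , cong suc ∣q∣≡t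
superset-of-size {suc n} (outside ∷ p) {t} ∣p∣≤t t≤1+n with t ≤? n
... | yes t≤n = let q , p⊆q , ∣q∣≡t = superset-of-size p ∣p∣≤t t≤n in outside ∷ q , s⊆s p⊆q , ∣q∣≡t
... | no  t≰n = let q , p⊆q , ∣q∣≡n = superset-of-size p (∣p∣≤n p) ≤-refl in
  inside ∷ q , out⊆ p⊆q , trans (cong suc ∣q∣≡n) (≤-antisym (≰⇒> t≰n) t≤1+n)

outside? : ∀ (p : Subset n) → Dec (∃ λ x → x ∉ p)
outside? p = any? (λ x → ¬? (x ∈? p))

-- The default d is returned only when p = ⊤.
pickOutside : Fin n → Subset n → Fin n
pickOutside d p with outside? p
... | yes (x , _) = x
... | no  _       = d

pickOutside-∉ : ∀ d (p : Subset n) → ∃ (λ x → x ∉ p) → pickOutside d p ∉ p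
pickOutside-∉ d p ∃∉ with outside? p
... | yes (_ , x∉p) = x∉p
... | no  ∄         = contradiction ∃∉ ∄

interval : ∀ n → ℕ → ℕ → Subset n
interval zero    _       _         = []
interval (suc n) (suc a) len       = outside ∷ interval n a len
interval (suc n) zero    zero      = outside ∷ interval n zero zero
interval (suc n) zero    (suc len) = inside ∷ interval n zero len

interval⁺ : ∀ a len (x : Fin n) → a ≤ toℕ x → toℕ x < a + len → x ∈ interval n a len
interval⁺ zero    (suc len) zero    _         _         = here
interval⁺ zero    (suc len) (suc x) _         (s≤s x<l) = there (interval⁺ zero len x z≤n x<l)
interval⁺ (suc a) len       (suc x) (s≤s a≤x) (s≤s x<u) = there (interval⁺ a len x a≤x x<u)

interval⁻ : ∀ a len (x : Fin n) → x ∈ interval n a len → a ≤ toℕ x × toℕ x < a + len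
interval⁻ zero    (suc len) zero    here = z≤n , s≤s z≤n
interval⁻ zero    (suc len) (suc x) (there x∈) = z≤n , s≤s (proj₂ (interval⁻ zero len x x∈))
interval⁻ zero    zero      (suc x) (there x∈) with () ← proj₂ (interval⁻ zero zero x x∈)
interval⁻ (suc a) len       (suc x) (there x∈) = map s≤s s≤s (interval⁻ a len x x∈)

interval⁺-offset : ∀ a b len (x : Fin n) r → toℕ x ≡ r + a → b ≤ r → r < b + len →
                   x ∈ interval n (a + b) len
interval⁺-offset a b len x r x≡r+a b≤r r<b+len = interval⁺ (a + b) len x lower upper
  where
  open ≤-Reasoning
  lower : a + b ≤ toℕ x
  lower = begin a + b ≤⟨ +-monoʳ-≤ a b≤r ⟩ a + r ≡⟨ +-comm a r ⟩ r + a ≡⟨ x≡r+a ⟨ toℕ x ∎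
  upper : toℕ x < a + b + len
  upper = begin-strict
    toℕ x          ≡⟨ trans x≡r+a (+-comm r a) ⟩
    a + r          <⟨ +-monoʳ-< a r<b+len ⟩
    a + (b + len)  ≡⟨ +-assoc a b len ⟨
    a + b + len    ∎

∣interval∣≤ : ∀ n a len → ∣ interval n a len ∣ ≤ len
∣interval∣≤ zero    _       _         = z≤n
∣interval∣≤ (suc n) (suc a) len       = ∣interval∣≤ n a len
∣interval∣≤ (suc n) zero    zero      = ∣interval∣≤ n zero zero
∣interval∣≤ (suc n) zero    (suc len) = s≤s (∣interval∣≤ n zero len)

∣interval∣≡ : ∀ n a len → a + len ≤ n → ∣ interval n a len ∣ ≡ len
∣interval∣≡ zero    zero    zero      _         = refl
∣interval∣≡ (suc n) (suc a) len       (s≤s a+l≤n) = ∣interval∣≡ n a len a+l≤n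
∣interval∣≡ (suc n) zero    zero      _         = ∣interval∣≡ n zero zero z≤n
∣interval∣≡ (suc n) zero    (suc len) (s≤s l≤n) = cong suc (∣interval∣≡ n zero len l≤n)

nCk≤[1+n]Ck : ∀ n k → n C k ≤ suc n C k
nCk≤[1+n]Ck n zero    = ≤-refl
nCk≤[1+n]Ck n (suc k) = subst (n C suc k ≤_) (nCk+nC[k+1]≡[n+1]C[k+1] n k) (m≤n+m _ _)

-- Position of p in the lexicographic order (outside before inside) on the subsets of size ∣ p ∣.
rank : Subset n → ℕ
rank []                   = 0
rank (outside ∷ p)        = rank p
rank {suc n} (inside ∷ p) = n C suc ∣ p ∣ + rank p

rank< : ∀ (p : Subset n) → rank p < n C ∣ p ∣
rank< []                   = s≤s z≤n
rank< {suc n} (outside ∷ p) = ≤-trans (rank< p) (nCk≤[1+n]Ck n ∣ p ∣)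
rank< {suc n} (inside ∷ p)  = begin-strict
  n C suc ∣ p ∣ + rank p        <⟨ +-monoʳ-< (n C suc ∣ p ∣) (rank< p) ⟩
  n C suc ∣ p ∣ + n C ∣ p ∣     ≡⟨ +-comm (n C suc ∣ p ∣) _ ⟩
  n C ∣ p ∣ + n C suc ∣ p ∣     ≡⟨ nCk+nC[k+1]≡[n+1]C[k+1] n ∣ p ∣ ⟩
  suc n C suc ∣ p ∣             ∎
  where open ≤-Reasoning

rank-outside≢inside : ∀ (p q : Subset n) → ∣ p ∣ ≡ suc ∣ q ∣ → rank (outside ∷ p) ≢ rank (inside ∷ q)
rank-outside≢inside {n} p q ∣p∣≡1+∣q∣ = <⇒≢ (begin-strict
  rank p                    <⟨ rank< p ⟩
  n C ∣ p ∣                 ≡⟨ cong (n C_) ∣p∣≡1+∣q∣ ⟩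
  n C suc ∣ q ∣             ≤⟨ m≤m+n _ (rank q) ⟩
  n C suc ∣ q ∣ + rank q    ∎)
  where open ≤-Reasoning

rank-injective : ∀ (p q : Subset n) → ∣ p ∣ ≡ ∣ q ∣ → rank p ≡ rank q → p ≡ q
rank-injective []            []            _ _ = refl
rank-injective (outside ∷ p) (outside ∷ q) ∣p∣≡∣q∣ rp≡rq =
  cong (outside ∷_) (rank-injective p q ∣p∣≡∣q∣ rp≡rq)
rank-injective {suc n} (inside ∷ p) (inside ∷ q) ∣p∣≡∣q∣ rp≡rq =
  cong (inside ∷_) (rank-injective p q sizes ranks)
  where
  sizes : ∣ p ∣ ≡ ∣ q ∣
  sizes = suc-injective ∣p∣≡∣q∣
  ranks : rank p ≡ rank q
  ranks = +-cancelˡ-≡ (n C suc ∣ p ∣) _ _ (trans rp≡rq (cong (λ k → n C suc k + rank q) (sym sizes)))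
rank-injective (outside ∷ p) (inside ∷ q) ∣p∣≡∣q∣ rp≡rq =
  contradiction rp≡rq (rank-outside≢inside p q ∣p∣≡∣q∣)
rank-injective (inside ∷ p) (outside ∷ q) ∣p∣≡∣q∣ rp≡rq =
  contradiction (sym rp≡rq) (rank-outside≢inside q p (sym ∣p∣≡∣q∣))

ranked? : ∀ n t i → Dec (∃ λ (p : Subset n) → ∣ p ∣ ≡ t × rank p ≡ i)
ranked? n t i = anySubset? (λ p → ∣ p ∣ ≟ t ×-dec rank p ≟ i)

-- Inverse of rank on the subsets of size t; ⊥ for indices i ≥ n C t.
unrank : ∀ n t → ℕ → Subset n
unrank n t i with ranked? n t i
... | yes (p , _) = p
... | no  _       = ⊥

unrank-rank : ∀ {t} (p : Subset n) → ∣ p ∣ ≡ t → unrank n t (rank p) ≡ p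
unrank-rank {n} {t} p ∣p∣≡t with ranked? n t (rank p)
... | yes (q , ∣q∣≡t , rq≡rp) = rank-injective q p (trans ∣q∣≡t (sym ∣p∣≡t)) rq≡rp
... | no  ∄                   = contradiction (p , ∣p∣≡t , refl) ∄

rank-unrank : ∀ {t} i → ∣ unrank n (suc t) i ∣ ≡ suc t → rank (unrank n (suc t) i) ≡ i
rank-unrank {n} {t} i with ranked? n (suc t) i
... | yes (_ , _ , rp≡i) = λ _ → rp≡i
... | no  _              = λ ∣⊥∣≡1+t → contradiction (trans (sym (∣⊥∣≡0 n)) ∣⊥∣≡1+t) λ ()

∣unrank∣≤ : ∀ n t i → ∣ unrank n t i ∣ ≤ t
∣unrank∣≤ n t i with ranked? n t i
... | yes (_ , ∣p∣≡t , _) = ≤-reflexive ∣p∣≡t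
... | no  _              = subst (_≤ t) (sym (∣⊥∣≡0 n)) z≤n

/-unique : ∀ {m d q} .{{_ : NonZero d}} → q * d ≤ m → m < q * d + d → m / d ≡ q
/-unique {m} {d} {q} qd≤m m<qd+d = ≤-antisym
  (≤-pred (m<n*o⇒m/o<n {m} {suc q} {d} (subst (m <_) (+-comm (q * d) d) m<qd+d)))
  (subst (_≤ m / d) (m*n/n≡m q d) (/-monoˡ-≤ d qd≤m))

m*[k+k]≡2*m*k : ∀ m k → m * (k + k) ≡ 2 * m * k
m*[k+k]≡2*m*k = solve-∀

xor-swap-not : ∀ a b c → b xor a xor not c ≡ not (a xor b xor c)
xor-swap-not false false c = refl
xor-swap-not false true  c = refl
xor-swap-not true  false c = refl
xor-swap-not true  true  c = refl

xor≡true⇒ : ∀ a b c → a xor b xor c ≡ true → b ≡ not (a xor c)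
xor≡true⇒ false false true  _ = refl
xor≡true⇒ false true  false _ = refl
xor≡true⇒ true  false false _ = refl
xor≡true⇒ true  true  true  _ = refl

if-not : ∀ {A : Set} b (x y : A) → (if b then x else y) ≡ (if not b then y else x)
if-not true  x y = refl
if-not false x y = refl

anyFin⁺ : ∀ (p : Fin n → Bool) i → p i ≡ true → anyFin p ≡ true
anyFin⁺ p zero    pi≡true = cong (_∨ anyFin (p ∘ suc)) pi≡true
anyFin⁺ p (suc i) pi≡true =
  trans (cong (p zero ∨_) (anyFin⁺ (p ∘ suc) i pi≡true)) (Bool.∨-zeroʳ (p zero))

col∈colourSet : ∀ (f : Colouring n r) (H : Subgraph n) {i j} → E H i j ≡ true → col f i j ∈ colourSet f H
col∈colourSet f H {i} {j} ij∈E = lookup⇒[]= (col f i j) (colourSet f H) (trans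
  (lookup∘tabulate _ (col f i j))
  (anyFin⁺ _ i (anyFin⁺ _ j (cong₂ _∧_ ij∈E ⌊c≟c⌋))))
  where
  ⌊c≟c⌋ : ⌊ col f i j Fin.≟ col f i j ⌋ ≡ true
  ⌊c≟c⌋ = trans (isYes≗does (col f i j Fin.≟ col f i j)) (dec-true (col f i j Fin.≟ col f i j) refl)

reach-start-∉ : ∀ {H : Subgraph n} {D u v} → Reach H D u v → u ∉ D
reach-start-∉ (here _ u∉D)   = u∉D
reach-start-∉ (step u∉D _ _) = u∉D

reach-first-step : ∀ {H : Subgraph n} {D u v} → Reach H D v u → u ≢ v → ∃ λ w → E H v w ≡ true × w ∉ D
reach-first-step (here _ _)         u≢v = contradiction refl u≢v
reach-first-step (step _ vw∈E walk) _   = _ , vw∈E , reach-start-∉ walk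

neighbour-outside : ∀ {k} (H : Subgraph n) {D v} → KConnected k H → ∣ D ∣ < k → v ∈ V H → v ∉ D →
                    ∃ λ w → E H v w ≡ true × w ∉ D
neighbour-outside {k = k} H {D} {v} (k<∣V∣ , connected) ∣D∣<k v∈V v∉D
  with ∣p∣<∣q∣⇒∃∈q∉p {p = D ∪ ⁅ v ⁆} {q = V H} ∣D∪v∣<∣V∣
  where
  ∣D∪v∣<∣V∣ : ∣ D ∪ ⁅ v ⁆ ∣ < ∣ V H ∣
  ∣D∪v∣<∣V∣ = begin-strict
    ∣ D ∪ ⁅ v ⁆ ∣        ≤⟨ ∣p∪q∣≤∣p∣+∣q∣ D ⁅ v ⁆ ⟩
    ∣ D ∣ + ∣ ⁅ v ⁆ ∣    ≡⟨ cong (∣ D ∣ +_) (∣⁅x⁆∣≡1 v) ⟩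
    ∣ D ∣ + 1            <⟨ +-monoˡ-< 1 ∣D∣<k ⟩
    k + 1                ≤⟨ k<∣V∣ ⟩
    ∣ V H ∣              ∎
    where open ≤-Reasoning
... | u , u∈V , u∉D∪v = reach-first-step (connected D ∣D∣<k v u v∈V v∉D u∈V (u∉D∪v ∘ x∈p∪q⁺ ∘ inj₁)) u≢v
  where
  u≢v : u ≢ v
  u≢v refl = u∉D∪v (x∈p∪q⁺ (inj₂ (x∈⁅x⁆ v)))

Confines : Colouring n r → Subset r → Fin n → Subset n → Set
Confines f A v D = ∀ w → col f v w ∈ A → w ∈ D

confined⇒∉V : ∀ {k} (f : Colouring n r) (H : Subgraph n) {A D v} → KConnected k H → colourSet f H ⊆ A →
              ∣ D ∣ < k → Confines f A v D → v ∉ V H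
-- D - v rather than D, since v itself may lie in D.
confined⇒∉V f H {A} {D} {v} kH colours⊆A ∣D∣<k confines v∈V
  with neighbour-outside H kH (≤-<-trans (∣p─q∣≤∣p∣ D ⁅ v ⁆) ∣D∣<k) v∈V (x∉p-x D v)
... | w , vw∈E , w∉D-v =
  w∉D-v (x∈p∧x≢y⇒x∈p-y (confines w (colours⊆A (col∈colourSet f H vw∈E))) (Eirr H v w vw∈E ∘ sym))

-- For complementary labels, outward x y says that the colour of xy is taken from A x. It is
-- antisymmetric on such pairs, which makes the colouring symmetric, and among the vertices whose
-- label is complementary to that of v it holds exactly for those of half target v.
module LabelColouring {n m} (A : Fin n → Subset (suc m)) (half : Fin n → Bool)
                      (fits : ∀ x y → ∣ A y ∣ ≤ ∣ ∁ (A x) ∣) where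

  primary : Fin n → Bool
  primary x = lookup (A x) zero

  outward : Fin n → Fin n → Bool
  outward x y = half x xor half y xor primary x

  target : Fin n → Bool
  target v = not (half v xor primary v)

  full? : ∀ x y → Dec (A x ∪ A y ≡ ⊤)
  full? x y = ≡-dec Bool._≟_ (A x ∪ A y) ⊤

  forbidden : Fin n → Fin n → Subset (suc m)
  forbidden x y with full? x y
  ... | yes _ = if outward x y then A y else A x
  ... | no  _ = A x ∪ A y

  complementary : ∀ {x y} → A x ∪ A y ≡ ⊤ → A y ≡ ∁ (A x)
  complementary {x} {y} = ∪≡⊤⇒≡∁ (fits x y)

  outward-antisym : ∀ {x y} → A x ∪ A y ≡ ⊤ → outward y x ≡ not (outward x y)
  outward-antisym {x} {y} full = trans
    (cong (λ b → half y xor half x xor b) primary-y≡not-primary-x)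
    (xor-swap-not (half x) (half y) (primary x))
    where
    primary-y≡not-primary-x : primary y ≡ not (primary x)
    primary-y≡not-primary-x = trans (cong (λ p → lookup p zero) (complementary full)) (lookup-map zero not (A x))

  forbidden-sym : ∀ x y → forbidden x y ≡ forbidden y x
  forbidden-sym x y with full? x y | full? y x
  ... | yes full | yes _     = trans (if-not (outward x y) (A y) (A x))
                                     (cong (λ b → if b then A x else A y) (sym (outward-antisym full)))
  ... | yes full | no ¬full  = contradiction (trans (∪-comm (A y) (A x)) full) ¬full
  ... | no ¬full | yes full  = contradiction (trans (∪-comm (A x) (A y)) full) ¬full
  ... | no _     | no _      = ∪-comm (A x) (A y)

  colouring : Colouring n (suc m)
  colouring = record
    { col = λ x y → pickOutside zero (forbidden x y)
    ; sym = λ x y → cong (pickOutside zero) (forbidden-sym x y)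
    }

  A≢⊤ : ∀ x → A x ≢ ⊤
  A≢⊤ x Ax≡⊤ = contradiction (begin
    suc m                ≡⟨ ∣A∣≡1+m ⟨
    ∣ A x ∣              ≤⟨ fits x x ⟩
    ∣ ∁ (A x) ∣          ≡⟨ ∣∁p∣≡n∸∣p∣ (A x) ⟩
    suc m ∸ ∣ A x ∣      ≡⟨ cong (suc m ∸_) ∣A∣≡1+m ⟩
    suc m ∸ suc m        ≡⟨ n∸n≡0 (suc m) ⟩
    0                    ∎) λ ()
    where
    open ≤-Reasoning
    ∣A∣≡1+m : ∣ A x ∣ ≡ suc m
    ∣A∣≡1+m = trans (cong ∣_∣ Ax≡⊤) (∣⊤∣≡n (suc m))

  own-colour⇒partner : ∀ v w → col colouring v w ∈ A v → A w ≡ ∁ (A v) × half w ≡ target v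
  own-colour⇒partner v w c∈Av with full? v w
  ... | no ¬full = contradiction (x∈p∪q⁺ (inj₁ c∈Av)) (pickOutside-∉ zero (A v ∪ A w) (p≢⊤⇒∃∉ ¬full))
  ... | yes full with outward v w in outward≡
  ...   | true  = complementary full , xor≡true⇒ (half v) (half w) (primary v) outward≡
  ...   | false = contradiction c∈Av (pickOutside-∉ zero (A v) (p≢⊤⇒∃∉ (A≢⊤ v)))

-- S = s, K = k − 1, and L = 2(k − 1) is the length of the block of vertices sharing a label.
module Construction (s' k' n : ℕ) where

  S K L : ℕ
  S = suc s'
  K = suc k'
  L = K + K

  label : Fin n → Subset (2 * S)
  label x = unrank (2 * S) S (toℕ x / L)

  half : Fin n → Bool
  half x = does (toℕ x % L <? K)

  block : ℕ → Subset n
  block q = interval n (q * L) L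

  2S∸S≡S : 2 * S ∸ S ≡ S
  2S∸S≡S = trans (m+n∸m≡n S (S + 0)) (+-identityʳ S)

  ∣label∣≤S : ∀ x → ∣ label x ∣ ≤ S
  ∣label∣≤S x = ∣unrank∣≤ (2 * S) S (toℕ x / L)

  ∣∁p∣≡S : ∀ (p : Subset (2 * S)) → ∣ p ∣ ≡ S → ∣ ∁ p ∣ ≡ S
  ∣∁p∣≡S p ∣p∣≡S = trans (∣∁p∣≡n∸∣p∣ p) (trans (cong (2 * S ∸_) ∣p∣≡S) 2S∸S≡S)

  fits : ∀ x y → ∣ label y ∣ ≤ ∣ ∁ (label x) ∣
  fits x y = begin
    ∣ label y ∣            ≤⟨ ∣label∣≤S y ⟩
    S                      ≡⟨ 2S∸S≡S ⟨
    2 * S ∸ S              ≤⟨ ∸-monoʳ-≤ (2 * S) (∣label∣≤S x) ⟩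
    2 * S ∸ ∣ label x ∣    ≡⟨ ∣∁p∣≡n∸∣p∣ (label x) ⟨
    ∣ ∁ (label x) ∣        ∎
    where open ≤-Reasoning

  open LabelColouring label half fits public

  offset : Bool → ℕ
  offset true  = 0
  offset false = K

  half-interval : ∀ x → x ∈ interval n (toℕ x / L * L + offset (half x)) K
  half-interval x = by-half (toℕ x % L <? K)
    where
    x≡r+qL : toℕ x ≡ toℕ x % L + toℕ x / L * L
    x≡r+qL = m≡m%n+[m/n]*n (toℕ x) L
    by-half : (r<K? : Dec (toℕ x % L < K)) → x ∈ interval n (toℕ x / L * L + offset (does r<K?)) K
    by-half (yes r<K) = interval⁺-offset _ 0 K x _ x≡r+qL z≤n r<K
    by-half (no  r≮K) = interval⁺-offset _ K K x _ x≡r+qL (≮⇒≥ r≮K) (m%n<n (toℕ x) L)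

  label-block : ∀ q (x : Fin n) → x ∈ block q → label x ≡ unrank (2 * S) S q
  label-block q x x∈block = cong (unrank (2 * S) S) (/-unique (proj₁ bounds) (proj₂ bounds))
    where
    bounds : q * L ≤ toℕ x × toℕ x < q * L + L
    bounds = interval⁻ (q * L) L x x∈block

  partners : Fin n → Subset n
  partners v = interval n (rank (∁ (label v)) * L + offset (target v)) K

  confines-partners : ∀ v → ∣ label v ∣ ≡ S → Confines colouring (label v) v (partners v)
  confines-partners v ∣label∣≡S w c∈label with own-colour⇒partner v w c∈label
  ... | label≡∁ , half≡target =
    subst₂ (λ q h → w ∈ interval n (q * L + offset h) K) block≡ half≡target (half-interval w)
    where
    ∣label-w∣≡S : ∣ label w ∣ ≡ S
    ∣label-w∣≡S = trans (cong ∣_∣ label≡∁) (∣∁p∣≡S (label v) ∣label∣≡S)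
    block≡ : toℕ w / L ≡ rank (∁ (label v))
    block≡ = trans (sym (rank-unrank {n = 2 * S} {t = s'} (toℕ w / L) ∣label-w∣≡S)) (cong rank label≡∁)

  block-avoids-H : ∀ H → KConnected (suc K) H → ∀ A → colourSet colouring H ⊆ A → ∣ A ∣ ≡ S →
                   ∀ {v} → v ∈ block (rank A) → v ∉ V H
  block-avoids-H H kH A colours⊆A ∣A∣≡S {v} v∈block =
    confined⇒∉V colouring H kH (subst (colourSet colouring H ⊆_) (sym label≡A) colours⊆A)
                (s≤s (∣interval∣≤ n (rank (∁ (label v)) * L + offset (target v)) K))
                (confines-partners v (trans (cong ∣_∣ label≡A) ∣A∣≡S))
    where
    label≡A : label v ≡ A
    label≡A = trans (label-block (rank A) v v∈block) (unrank-rank A ∣A∣≡S)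

  bound : 2 * ((2 * S) C S) * K + 1 ≤ n →
          ∀ H → KConnected (suc K) H → c colouring H ≤ S → ∣ V H ∣ ≤ n ∸ L
  bound room H kH c≤S =
    let A , colours⊆A , ∣A∣≡S = superset-of-size (colourSet colouring H) c≤S (m≤m+n S (S + 0))
    in  subst (λ m → ∣ V H ∣ ≤ n ∸ m) (∣interval∣≡ n (rank A * L) L (block-fits A ∣A∣≡S))
              (disjoint⇒∣q∣≤n∸∣p∣ (block-avoids-H H kH A colours⊆A ∣A∣≡S))
    where
    block-fits : ∀ A → ∣ A ∣ ≡ S → rank A * L + L ≤ n
    block-fits A ∣A∣≡S = begin
      rank A * L + L              ≡⟨ +-comm (rank A * L) L ⟩
      suc (rank A) * L            ≤⟨ *-monoˡ-≤ L (subst (rank A <_) (cong (2 * S C_) ∣A∣≡S) (rank< A)) ⟩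
      ((2 * S) C S) * L           ≡⟨ m*[k+k]≡2*m*k ((2 * S) C S) K ⟩
      2 * ((2 * S) C S) * K       ≤⟨ m≤m+n _ 1 ⟩
      2 * ((2 * S) C S) * K + 1   ≤⟨ room ⟩
      n                           ∎
      where open ≤-Reasoning

monochromatic : ∀ {n r} → Colouring n (suc r)
monochromatic = record { col = λ _ _ → zero ; sym = λ _ _ → refl }

n∸[k+k]≡n+2∸2*[1+k] : ∀ n k → n ∸ (k + k) ≡ n + 2 ∸ 2 * suc k
n∸[k+k]≡n+2∸2*[1+k] n k = cong₂ _∸_ (+-comm 2 n) (2+[k+k]≡2*[1+k] k)
  where
  2+[k+k]≡2*[1+k] : ∀ k → 2 + (k + k) ≡ 2 * suc k
  2+[k+k]≡2*[1+k] = solve-∀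

lemma4p2 : (n s k : ℕ) → 2 ≤ n → 1 ≤ s →
           2 * ((2 * s) C s) * (k ∸ 1) + 1 ≤ n →
           m≤ n (2 * s) s k (n + 2 ∸ 2 * k)
-- For k ≤ 1 the bound is at least n.
lemma4p2 _ zero     _              _ ()  _
lemma4p2 n (suc s') zero           _ _ _    = monochromatic , λ H _ _ → ≤-trans (∣p∣≤n (V H)) (m≤m+n n 2)
lemma4p2 n (suc s') (suc zero)     _ _ _    =
  monochromatic , λ H _ _ → ≤-trans (∣p∣≤n (V H)) (≤-reflexive (sym (m+n∸n≡m n 2)))
lemma4p2 n (suc s') (suc (suc k')) _ _ room = colouring , λ H kH c≤s →
  subst (∣ V H ∣ ≤_) (n∸[k+k]≡n+2∸2*[1+k] n (suc k')) (bound room H kH c≤s)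
  where open Construction s' k' n
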